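{- Suppose there exists a shifted LLA $P^S$ of capacity $n$ with maximum spread $m-1$ that handles a sequence of insertions $\sigma$ with $T(n)$ total element movements. Then there exists a list labeling array $P^*$ with $3m$ slots (labels in $\{1,\dots,3m\}$) that handles $\sigma$ with at most $2T(n)$ total element movements.
   Context: In the (classic) online list labeling problem, elements from a totally ordered universe arrive online and each must be assigned a label in $\{1,\dots,M\}$ (an array of $M$ slots) such that at all times $x<y$ implies label$(x)<$label$(y)$; a data structure for it is a list labeling array (LLA) of size $M$. In the shifted list labeling problem, up to $n$ elements arrive online and are assigned integer labels respecting sorted order, with the only constraint on the labels being that at all times the smallest and largest labels differ by at most $m-1$; a data structure for this is a shifted LLA with maximum spread $m-1$. In both problems an element movement occurs each time an element is assigned a new label. -}

module Defs where

open import Data.Nat as ℕ using (ℕ; suc; zero)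
open import Data.Integer as ℤ using (ℤ; +_)
open import Data.Product using (_×_)
open import Data.List using (List; take; length; filter; map; upTo)
open import Data.Nat.ListAction using (sum)
open import Data.List.Membership.Propositional using (_∈_)
open import Relation.Nullary.Decidable using (¬?)
open import Relation.Binary.Definitions using (DecidableEquality)

-- A (deterministic, online) labeling algorithm over universe U with label type L:
-- given the insertions performed so far (in arrival order), it determines the
-- current label of every element.  Being a function of the prefix of insertions
-- only, the labeling after k insertions cannot depend on future insertions.
Algorithm : Set → Set → Set
Algorithm U L = List U → U → L

module _ {U L : Set} (_≟L_ : DecidableEquality L) (A : Algorithm U L) (σ : List U) where

  -- Element movements caused by the (k+1)-st insertion (k < length σ):
  -- the newly inserted element receives a label (1 movement), plus every
  -- previously present element whose label changed.
  movesAt : ℕ → ℕ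
  movesAt k = suc (length (filter (λ x → ¬? (A (take (suc k) σ) x ≟L A (take k σ) x)) (take k σ)))

  totalMovesWith : ℕ
  totalMovesWith = sum (map movesAt (upTo (length σ)))

shiftedMoves : {U : Set} → Algorithm U ℤ → List U → ℕ
shiftedMoves = totalMovesWith ℤ._≟_

classicMoves : {U : Set} → Algorithm U ℕ → List U → ℕ
classicMoves = totalMovesWith ℕ._≟_

OrderRespecting : {U L : Set} (_<U_ : U → U → Set) (_<L_ : L → L → Set) →
                  Algorithm U L → List U → Set
OrderRespecting _<U_ _<L_ A σ =
  ∀ k → k ℕ.≤ length σ → ∀ x y → x ∈ take k σ → y ∈ take k σ →
  x <U y → A (take k σ) x <L A (take k σ) y

ShiftedHandles : {U : Set} (_<U_ : U → U → Set) (m : ℕ) → Algorithm U ℤ → List U → Set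
ShiftedHandles _<U_ m A σ =
  OrderRespecting _<U_ ℤ._<_ A σ ×
  (∀ k → k ℕ.≤ length σ → ∀ x y → x ∈ take k σ → y ∈ take k σ →
   A (take k σ) x ℤ.- A (take k σ) y ℤ.≤ + m ℤ.- + 1)

ClassicHandles : {U : Set} (_<U_ : U → U → Set) (M : ℕ) → Algorithm U ℕ → List U → Set
ClassicHandles _<U_ M A σ =
  OrderRespecting _<U_ ℕ._<_ A σ ×
  (∀ k → k ℕ.≤ length σ → ∀ x → x ∈ take k σ →
   1 ℕ.≤ A (take k σ) x × A (take k σ) x ℕ.≤ M)

{-# OPTIONS --safe #-}
module Submission where

-- P* shows the labels of PS through a window of 3m consecutive integers, labelling an element by
-- the offset of its PS-label from the window's base.  While every label stays in the window, P*
-- moves exactly the elements PS moves.  When a label leaves it, P* recentres the window so that all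
-- labels lie in its middle third (possible as the spread is below m) and relabels everything.
-- An element still at the label it had at the last recentring lies in the middle third, so all
-- labels, being within m - 1 of it, lie in the window; hence at a recentring every present element
-- has been moved by PS since the previous one.  With the number of such elements as potential,
-- every PS-move is paid twice: when it happens and at the next recentring.

open import Defs
open import Data.Nat using (ℕ; _≤_; _*_)
open import Data.Integer using (ℤ)
open import Data.Product using (∃; _×_)
open import Data.List using (List; length)
open import Data.List.Relation.Unary.Unique.Propositional using (Unique)
open import Relation.Binary.PropositionalEquality using (_≡_)
open import Relation.Binary.Structures using (IsStrictTotalOrder)

open import Data.Nat as ℕ using (zero; suc; z≤n; s≤s; _<_; _+_)
import Data.Nat.Properties as ℕP
open import Data.Integer as ℤ using (+_; 0ℤ; 1ℤ; ∣_∣; +≤+)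
import Data.Integer.Properties as ℤP
open import Data.Integer.Tactic.RingSolver using (solve-∀)
import Data.Nat.Tactic.RingSolver as ℕRing
open import Data.Nat.ListAction using (sum)
open import Data.Nat.ListAction.Properties using (sum-++)
open import Data.Fin using (fromℕ<)
open import Data.Fin.Properties using (toℕ-fromℕ<)
open import Data.List using ([]; _∷_; lookup; _∷ʳ_; [_]; take; filter; map; upTo)
open import Data.List.Properties
  using (length-filter; filter-accept; filter-all; filter-none; filter-++; length-++;
         map-++; upTo-∷ʳ; take-suc; length-take; take-take)
open import Data.Product using (_,_; proj₁; proj₂)
open import Data.List.Relation.Unary.All as All using (All; []; _∷_)
open import Data.List.Relation.Unary.Any using (here; there)
open import Data.List.Membership.Propositional using (_∈_)
open import Data.List.Membership.Propositional.Properties using (∈-++⁺ˡ)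
open import Data.Sum using (_⊎_; inj₁; inj₂)
open import Data.Empty using (⊥-elim)
open import Function using (_∘_)
open import Relation.Nullary using (yes; no; ¬_; Dec)
open import Relation.Nullary.Decidable using (¬?; _×-dec_)
open import Relation.Unary using (Decidable)
open import Relation.Unary.Properties using (U?)
open import Relation.Binary.Definitions using (DecidableEquality)
open import Relation.Binary.PropositionalEquality using (refl; sym; trans; cong; subst; subst₂; cong₂; module ≡-Reasoning)

module _ {A : Set} where

  length-filter-∷ : ∀ {P : A → Set} (P? : Decidable P) x xs →
                    length (filter P? xs) ≤ length (filter P? (x ∷ xs))
  length-filter-∷ P? x xs with P? x
  ... | yes _ = ℕP.n≤1+n _
  ... | no _  = ℕP.≤-refl

  length-filter-∷ʳ : ∀ {P : A → Set} (P? : Decidable P) xs x →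
                     length (filter P? (xs ∷ʳ x)) ≤ length (filter P? xs) + 1
  length-filter-∷ʳ P? xs x rewrite filter-++ P? xs [ x ] | length-++ (filter P? xs) {filter P? [ x ]} =
    ℕP.+-monoʳ-≤ (length (filter P? xs)) (length-filter P? [ x ])

  length-filter-mono : ∀ {P Q : A → Set} (P? : Decidable P) (Q? : Decidable Q) xs →
                       (∀ {x} → x ∈ xs → P x → Q x) →
                       length (filter P? xs) ≤ length (filter Q? xs)
  length-filter-mono P? Q? [] _ = z≤n
  length-filter-mono P? Q? (x ∷ xs) P⇒Q with P? x
  ... | no _   = ℕP.≤-trans (length-filter-mono P? Q? xs (P⇒Q ∘ there)) (length-filter-∷ Q? x xs)
  ... | yes px = ℕP.≤-trans (s≤s (length-filter-mono P? Q? xs (P⇒Q ∘ there)))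
                            (ℕP.≤-reflexive (cong length (sym (filter-accept Q? (P⇒Q (here refl) px)))))

  length-filter-⊎ : ∀ {P Q R : A → Set} (P? : Decidable P) (Q? : Decidable Q) (R? : Decidable R) xs →
                    (∀ {x} → x ∈ xs → P x → Q x ⊎ R x) →
                    length (filter P? xs) ≤ length (filter Q? xs) + length (filter R? xs)
  length-filter-⊎ P? Q? R? [] _ = z≤n
  length-filter-⊎ P? Q? R? (x ∷ xs) P⇒Q⊎R with P? x | length-filter-⊎ P? Q? R? xs (P⇒Q⊎R ∘ there)
  ... | no _  | ih = ℕP.≤-trans ih (ℕP.+-mono-≤ (length-filter-∷ Q? x xs) (length-filter-∷ R? x xs))
  ... | yes px | ih with P⇒Q⊎R (here refl) px
  ...   | inj₁ qx = ℕP.≤-trans (s≤s (ℕP.≤-trans ih (ℕP.+-monoʳ-≤ _ (length-filter-∷ R? x xs))))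
                     (ℕP.≤-reflexive (cong (λ ys → length ys + _) (sym (filter-accept Q? qx))))
  ...   | inj₂ rx = ℕP.≤-trans (s≤s (ℕP.≤-trans ih (ℕP.+-monoˡ-≤ _ (length-filter-∷ Q? x xs))))
                     (ℕP.≤-reflexive (trans (sym (ℕP.+-suc _ _))
                       (cong (λ ys → _ + length ys) (sym (filter-accept R? rx)))))

  length≤length-filter-⊎ : ∀ {Q R : A → Set} (Q? : Decidable Q) (R? : Decidable R) xs →
                           (∀ {x} → x ∈ xs → Q x ⊎ R x) →
                           length xs ≤ length (filter Q? xs) + length (filter R? xs)
  length≤length-filter-⊎ Q? R? xs cover =
    subst (_≤ length (filter Q? xs) + length (filter R? xs))
      (cong length (filter-all U? (All.universal (λ _ → _) xs)))
      (length-filter-⊎ U? Q? R? xs (λ x∈ _ → cover x∈))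

  take-suc-∷ʳ : ∀ k (xs : List A) → k < length xs → ∃ λ v → take (suc k) xs ≡ take k xs ∷ʳ v
  take-suc-∷ʳ k xs k<n =
    _ , subst (λ i → take (suc i) xs ≡ take i xs ∷ʳ lookup xs (fromℕ< k<n))
              (toℕ-fromℕ< k<n) (take-suc xs (fromℕ< k<n))

  length-take-≤ : ∀ k (xs : List A) → k ≤ length xs → length (take k xs) ≡ k
  length-take-≤ k xs k≤n = trans (length-take k xs) (ℕP.m≤n⇒m⊓n≡m k≤n)

sumUpTo : (ℕ → ℕ) → ℕ → ℕ
sumUpTo f n = sum (map f (upTo n))

sumUpTo-suc : ∀ f n → sumUpTo f (suc n) ≡ sumUpTo f n + f n
sumUpTo-suc f n = begin
  sum (map f (upTo (suc n)))        ≡⟨ cong (sum ∘ map f) (upTo-∷ʳ n) ⟨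
  sum (map f (upTo n ∷ʳ n))         ≡⟨ cong sum (map-++ f (upTo n) [ n ]) ⟩
  sum (map f (upTo n) ∷ʳ f n)       ≡⟨ sum-++ (map f (upTo n)) [ f n ] ⟩
  sumUpTo f n + (f n + 0)           ≡⟨ cong (λ x → sumUpTo f n + x) (ℕP.+-identityʳ (f n)) ⟩
  sumUpTo f n + f n                 ∎
  where open ≡-Reasoning

sumUpTo-potential : ∀ (c : ℕ) (f g Φ : ℕ → ℕ) (N : ℕ) → Φ 0 ≡ 0 →
                    (∀ k → k < N → f k + Φ (suc k) ≤ Φ k + c * g k) →
                    sumUpTo f N ≤ c * sumUpTo g N
sumUpTo-potential c f g Φ N Φ0≡0 step =
  ℕP.≤-trans (ℕP.m≤m+n (sumUpTo f N) (Φ N)) (bound N ℕP.≤-refl)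
  where
  bound : ∀ j → j ≤ N → sumUpTo f j + Φ j ≤ c * sumUpTo g j
  bound zero    _   rewrite Φ0≡0 = z≤n
  bound (suc j) j<N = begin
    sumUpTo f (suc j) + Φ (suc j)       ≡⟨ cong (_+ Φ (suc j)) (sumUpTo-suc f j) ⟩
    sumUpTo f j + f j + Φ (suc j)       ≡⟨ ℕP.+-assoc (sumUpTo f j) (f j) (Φ (suc j)) ⟩
    sumUpTo f j + (f j + Φ (suc j))     ≤⟨ ℕP.+-monoʳ-≤ (sumUpTo f j) (step j j<N) ⟩
    sumUpTo f j + (Φ j + c * g j)       ≡⟨ ℕP.+-assoc (sumUpTo f j) (Φ j) (c * g j) ⟨
    sumUpTo f j + Φ j + c * g j         ≤⟨ ℕP.+-monoˡ-≤ (c * g j) (bound j (ℕP.<⇒≤ j<N)) ⟩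
    c * sumUpTo g j + c * g j           ≡⟨ ℕP.*-distribˡ-+ c (sumUpTo g j) (g j) ⟨
    c * (sumUpTo g j + g j)             ≡⟨ cong (λ x → c * x) (sumUpTo-suc g j) ⟨
    c * sumUpTo g (suc j)               ∎
    where open ℕP.≤-Reasoning

0≤i<j⇒∣i∣<∣j∣ : ∀ {i j} → 0ℤ ℤ.≤ i → i ℤ.< j → ∣ i ∣ < ∣ j ∣
0≤i<j⇒∣i∣<∣j∣ {i} {j} 0≤i i<j = ℤP.drop‿+<+ (subst₂ ℤ._<_ (sym (ℤP.0≤i⇒+∣i∣≡i 0≤i)) (sym (ℤP.0≤i⇒+∣i∣≡i 0≤j)) i<j)
  where
  0≤j : 0ℤ ℤ.≤ j
  0≤j = ℤP.≤-trans 0≤i (ℤP.<⇒≤ i<j)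

module Window (m : ℕ) where

  M : ℤ
  M = + m

  InWindow : ℤ → Set
  InWindow d = 1ℤ ℤ.≤ d × d ℤ.≤ M ℤ.+ M ℤ.+ M

  InMiddle : ℤ → Set
  InMiddle d = M ℤ.+ 1ℤ ℤ.≤ d × d ℤ.≤ M ℤ.+ M

  inWindow? : Decidable InWindow
  inWindow? d = (1ℤ ℤP.≤? d) ×-dec (d ℤP.≤? M ℤ.+ M ℤ.+ M)

  middle⇒window : ∀ {d} → InMiddle d → InWindow d
  middle⇒window (lo , hi) =
    ℤP.≤-trans (ℤP.+-monoˡ-≤ 1ℤ (+≤+ z≤n)) lo , ℤP.≤-trans hi (ℤP.i≤i+j (M ℤ.+ M) M)

  window⇒label : ∀ {d} → InWindow d → 1 ≤ ∣ d ∣ × ∣ d ∣ ≤ 3 * m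
  window⇒label {d} (lo , hi) =
      ℤP.drop‿+≤+ (subst (1ℤ ℤ.≤_) (sym +∣d∣≡d) lo)
    , ℕP.≤-trans (ℤP.drop‿+≤+ (subst (ℤ._≤ M ℤ.+ M ℤ.+ M) (sym +∣d∣≡d) hi))
                 (ℕP.≤-reflexive (trans (ℕP.+-assoc m m m) (cong (λ x → m + (m + x)) (sym (ℕP.+-identityʳ m)))))
    where
    +∣d∣≡d : + ∣ d ∣ ≡ d
    +∣d∣≡d = ℤP.0≤i⇒+∣i∣≡i (ℤP.≤-trans (+≤+ z≤n) lo)

  near-middle⇒window : ∀ {b s t} → InMiddle (s ℤ.- b) →
                       s ℤ.- t ℤ.≤ M ℤ.- 1ℤ → t ℤ.- s ℤ.≤ M ℤ.- 1ℤ → InWindow (t ℤ.- b)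
  near-middle⇒window {b} {s} {t} (lo , hi) s-t≤ t-s≤ = lower , upper
    where
    open ℤP.≤-Reasoning
    lower : 1ℤ ℤ.≤ t ℤ.- b
    lower = begin
      1ℤ                            ≤⟨ +≤+ (s≤s z≤n) ⟩
      + 2                           ≡⟨ two≡ M ⟩
      (M ℤ.+ 1ℤ) ℤ.- (M ℤ.- 1ℤ)     ≤⟨ ℤP.+-mono-≤ lo (ℤP.neg-mono-≤ s-t≤) ⟩
      (s ℤ.- b) ℤ.- (s ℤ.- t)       ≡⟨ cancel s b t ⟩
      t ℤ.- b                       ∎
      where
      two≡ : ∀ M → + 2 ≡ (M ℤ.+ 1ℤ) ℤ.- (M ℤ.- 1ℤ)
      two≡ = solve-∀
      cancel : ∀ s b t → (s ℤ.- b) ℤ.- (s ℤ.- t) ≡ t ℤ.- b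
      cancel = solve-∀
    upper : t ℤ.- b ℤ.≤ M ℤ.+ M ℤ.+ M
    upper = begin
      t ℤ.- b                       ≡⟨ ℤP.+-minus-telescope t s b ⟨
      (t ℤ.- s) ℤ.+ (s ℤ.- b)       ≤⟨ ℤP.+-mono-≤ (ℤP.≤-trans t-s≤ (ℤP.i-j≤i M 1ℤ)) hi ⟩
      M ℤ.+ (M ℤ.+ M)               ≡⟨ ℤP.+-assoc M M M ⟨
      M ℤ.+ M ℤ.+ M                 ∎

  above-minimum⇒middle : ∀ {mn s} → mn ℤ.≤ s → s ℤ.- mn ℤ.≤ M ℤ.- 1ℤ →
                         InMiddle (s ℤ.- (mn ℤ.- M ℤ.- 1ℤ))
  above-minimum⇒middle {mn} {s} mn≤s s-mn≤ = lower , upper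
    where
    open ℤP.≤-Reasoning
    offset : s ℤ.- (mn ℤ.- M ℤ.- 1ℤ) ≡ (s ℤ.- mn) ℤ.+ (M ℤ.+ 1ℤ)
    offset = regroup s mn M
      where
      regroup : ∀ s mn M → s ℤ.- (mn ℤ.- M ℤ.- 1ℤ) ≡ (s ℤ.- mn) ℤ.+ (M ℤ.+ 1ℤ)
      regroup = solve-∀
    lower : M ℤ.+ 1ℤ ℤ.≤ s ℤ.- (mn ℤ.- M ℤ.- 1ℤ)
    lower = begin
      M ℤ.+ 1ℤ                       ≤⟨ ℤP.+-monoˡ-≤ (M ℤ.+ 1ℤ) (ℤP.i≤j⇒0≤j-i mn≤s) ⟩
      (s ℤ.- mn) ℤ.+ (M ℤ.+ 1ℤ)      ≡⟨ offset ⟨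
      s ℤ.- (mn ℤ.- M ℤ.- 1ℤ)        ∎
    upper : s ℤ.- (mn ℤ.- M ℤ.- 1ℤ) ℤ.≤ M ℤ.+ M
    upper = begin
      s ℤ.- (mn ℤ.- M ℤ.- 1ℤ)        ≡⟨ offset ⟩
      (s ℤ.- mn) ℤ.+ (M ℤ.+ 1ℤ)      ≤⟨ ℤP.+-monoˡ-≤ (M ℤ.+ 1ℤ) s-mn≤ ⟩
      (M ℤ.- 1ℤ) ℤ.+ (M ℤ.+ 1ℤ)      ≡⟨ cancel M ⟩
      M ℤ.+ M                        ∎
      where
      cancel : ∀ M → (M ℤ.- 1ℤ) ℤ.+ (M ℤ.+ 1ℤ) ≡ M ℤ.+ M
      cancel = solve-∀

module Recentring {U : Set} (_≟_ : DecidableEquality U) (m : ℕ) (PS : Algorithm U ℤ) where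
  open Window m
  open import Data.List.Membership.DecPropositional _≟_ using (_∈?_)
  open import Data.List.Extrema ℤP.≤-totalOrder using (argmin; argmin-sel; f[argmin]≤f[⊤]; f[argmin]≤f[xs])

  Fits : List U → ℤ → Set
  Fits q b = All (λ x → InWindow (PS q x ℤ.- b)) q

  fits? : ∀ q b → Dec (Fits q b)
  fits? q b = All.all? (λ x → inWindow? (PS q x ℤ.- b)) q

  SpreadBounded : List U → Set
  SpreadBounded q = ∀ x y → x ∈ q → y ∈ q → PS q x ℤ.- PS q y ℤ.≤ M ℤ.- 1ℤ

  -- The base that puts the smallest label at offset m + 1, the start of the middle third.
  centredBase : List U → ℤ
  centredBase []      = 0ℤ
  centredBase (w ∷ l) = PS (w ∷ l) (argmin (PS (w ∷ l)) w l) ℤ.- M ℤ.- 1ℤ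

  centredBase-middle : ∀ q → SpreadBounded q → ∀ {x} → x ∈ q → InMiddle (PS q x ℤ.- centredBase q)
  centredBase-middle (w ∷ l) spread {x} x∈q = above-minimum⇒middle (minimal x∈q) (spread x z x∈q z∈q)
    where
    f : U → ℤ
    f = PS (w ∷ l)
    z : U
    z = argmin f w l
    z∈q : z ∈ w ∷ l
    z∈q with argmin-sel f w l
    ... | inj₁ z≡w = here z≡w
    ... | inj₂ z∈l = there z∈l
    minimal : ∀ {y} → y ∈ w ∷ l → f z ℤ.≤ f y
    minimal (here refl) = f[argmin]≤f[⊤] {f = f} w l
    minimal (there y∈l) = All.lookup (f[argmin]≤f[xs] {f = f} w l) y∈l

  middle-element⇒fits : ∀ q b → SpreadBounded q → ∀ {x} → x ∈ q → InMiddle (PS q x ℤ.- b) → Fits q b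
  middle-element⇒fits q b spread {x} x∈q middle =
    All.tabulate λ {y} y∈q → near-middle⇒window {b} {PS q x} {PS q y} middle (spread x y x∈q y∈q) (spread y x y∈q x∈q)

  record Frame : Set where
    constructor frame
    field
      recentredAt : ℕ
      base        : ℤ
  open Frame

  advance : List U → ℕ → Frame → Frame
  advance q k f with fits? q (base f)
  ... | yes _ = f
  ... | no _  = frame k (centredBase q)

  advance-cases : ∀ q k f → (Fits q (base f) × advance q k f ≡ f)
                          ⊎ (¬ Fits q (base f) × advance q k f ≡ frame k (centredBase q))
  advance-cases q k f with fits? q (base f)
  ... | yes fits = inj₁ (fits , refl)
  ... | no ¬fits = inj₂ (¬fits , refl)

  frameAfter : List U → ℕ → Frame
  frameAfter σ zero    = frame 0 0ℤ
  frameAfter σ (suc k) = advance (take (suc k) σ) (suc k) (frameAfter σ k)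

  frameAfter-take : ∀ j k σ → k ≤ j → frameAfter (take j σ) k ≡ frameAfter σ k
  frameAfter-take j zero    σ _   = refl
  frameAfter-take j (suc k) σ k<j =
    cong₂ (λ q f → advance q (suc k) f)
      (trans (take-take (suc k) j σ) (cong (λ i → take i σ) (ℕP.m≤n⇒m⊓n≡m k<j)))
      (frameAfter-take j k σ (ℕP.<⇒≤ k<j))

  P* : Algorithm U ℕ
  P* p x = ∣ PS p x ℤ.- base (frameAfter p (length p)) ∣

  module Analysis (_<U_ : U → U → Set) (σ : List U) (handles : ShiftedHandles _<U_ m PS σ) where

    N : ℕ
    N = length σ

    prefix : ℕ → List U
    prefix k = take k σ

    S : ℕ → U → ℤ
    S k = PS (prefix k)

    R : ℕ → ℕ
    R k = recentredAt (frameAfter σ k)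

    B : ℕ → ℤ
    B k = base (frameAfter σ k)

    spread : ∀ k → k ≤ N → SpreadBounded (prefix k)
    spread k k≤N = proj₂ handles k k≤N

    prefix-⊆ : ∀ k → k < N → ∀ {x} → x ∈ prefix k → x ∈ prefix (suc k)
    prefix-⊆ k k<N x∈ with take-suc-∷ʳ k σ k<N
    ... | _ , eq rewrite eq = ∈-++⁺ˡ x∈

    P*-label : ∀ k → k ≤ N → ∀ x → P* (prefix k) x ≡ ∣ S k x ℤ.- B k ∣
    P*-label k k≤N x rewrite length-take-≤ k σ k≤N | frameAfter-take k k σ ℕP.≤-refl = refl

    MiddleAtRecentring : Frame → Set
    MiddleAtRecentring f = ∀ {x} → x ∈ prefix (recentredAt f) → InMiddle (S (recentredAt f) x ℤ.- base f)

    middle-at-recentring : ∀ k → k ≤ N → MiddleAtRecentring (frameAfter σ k)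
    middle-at-recentring zero    _   = λ ()
    middle-at-recentring (suc k) k<N with advance-cases (prefix (suc k)) (suc k) (frameAfter σ k)
    ... | inj₁ (_ , eq) = subst MiddleAtRecentring (sym eq) (middle-at-recentring k (ℕP.<⇒≤ k<N))
    ... | inj₂ (_ , eq) = subst MiddleAtRecentring (sym eq) (centredBase-middle (prefix (suc k)) (spread (suc k) k<N))

    fits-always : ∀ k → k ≤ N → Fits (prefix k) (B k)
    fits-always zero    _   = []
    fits-always (suc k) k<N with advance-cases (prefix (suc k)) (suc k) (frameAfter σ k)
    ... | inj₁ (fits , eq) = subst (Fits (prefix (suc k)) ∘ base) (sym eq) fits
    ... | inj₂ (_ , eq)    = subst (Fits (prefix (suc k)) ∘ base) (sym eq)
      (All.tabulate (middle⇒window ∘ centredBase-middle (prefix (suc k)) (spread (suc k) k<N)))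

    classic-handles : ClassicHandles _<U_ (3 * m) P* σ
    classic-handles = order , range
      where
      order : OrderRespecting _<U_ ℕ._<_ P* σ
      order k k≤N x y x∈ y∈ x<y rewrite P*-label k k≤N x | P*-label k k≤N y =
        0≤i<j⇒∣i∣<∣j∣ (ℤP.≤-trans (+≤+ z≤n) (proj₁ (All.lookup (fits-always k k≤N) x∈)))
                      (ℤP.+-monoˡ-< (ℤ.- B k) (proj₁ handles k k≤N x y x∈ y∈ x<y))
      range : ∀ k → k ≤ N → ∀ x → x ∈ prefix k → 1 ≤ P* (prefix k) x × P* (prefix k) x ≤ 3 * m
      range k k≤N x x∈ rewrite P*-label k k≤N x = window⇒label (All.lookup (fits-always k k≤N) x∈)

    unchanged-since-recentring⇒fits : ∀ k → k < N → ∀ {x} → x ∈ prefix k → x ∈ prefix (R k) →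
                                   S (suc k) x ≡ S (R k) x → Fits (prefix (suc k)) (B k)
    unchanged-since-recentring⇒fits k k<N x∈ x∈R unchanged =
      middle-element⇒fits (prefix (suc k)) (B k) (spread (suc k) k<N) (prefix-⊆ k k<N x∈)
        (subst (λ s → InMiddle (s ℤ.- B k)) (sym unchanged) (middle-at-recentring k (ℕP.<⇒≤ k<N) x∈R))

    Displaced : ℕ → U → Set
    Displaced k x = ¬ (x ∈ prefix (R k) × S k x ≡ S (R k) x)

    displaced? : ∀ k → Decidable (Displaced k)
    displaced? k x = ¬? ((x ∈? prefix (R k)) ×-dec (S k x ℤ.≟ S (R k) x))

    Φ : ℕ → ℕ
    Φ k = length (filter (displaced? k) (prefix k))

    moved? : ∀ k → Decidable (λ x → ¬ S (suc k) x ≡ S k x)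
    moved? k x = ¬? (S (suc k) x ℤ.≟ S k x)

    movedByPS : ℕ → ℕ
    movedByPS k = length (filter (moved? k) (prefix k))

    shiftedMovesAt : ℕ → ℕ
    shiftedMovesAt = movesAt ℤ._≟_ PS σ

    classicMovesAt : ℕ → ℕ
    classicMovesAt = movesAt ℕ._≟_ P* σ

    step-without-recentring : ∀ k → k < N → R (suc k) ≡ R k → B (suc k) ≡ B k →
                           classicMovesAt k + Φ (suc k) ≤ Φ k + 2 * shiftedMovesAt k
    step-without-recentring k k<N R≡ B≡ = begin
      classicMovesAt k + Φ (suc k)                 ≤⟨ ℕP.+-mono-≤ classic≤shifted Φ-grows ⟩
      shiftedMovesAt k + (Φ k + shiftedMovesAt k)  ≡⟨ regroup (shiftedMovesAt k) (Φ k) ⟩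
      Φ k + 2 * shiftedMovesAt k                   ∎
      where
      open ℕP.≤-Reasoning
      regroup : ∀ a b → a + (b + a) ≡ b + 2 * a
      regroup = ℕRing.solve-∀
      classic≤shifted : classicMovesAt k ≤ shiftedMovesAt k
      classic≤shifted = s≤s (length-filter-mono _ (moved? k) (prefix k) λ {x} _ P*-moved S-same →
        P*-moved (begin-equality
          P* (prefix (suc k)) x         ≡⟨ P*-label (suc k) k<N x ⟩
          ∣ S (suc k) x ℤ.- B (suc k) ∣ ≡⟨ cong₂ (λ s b → ∣ s ℤ.- b ∣) S-same B≡ ⟩
          ∣ S k x ℤ.- B k ∣             ≡⟨ P*-label k (ℕP.<⇒≤ k<N) x ⟨
          P* (prefix k) x               ∎))
      displaced-or-moved : ∀ {x} → x ∈ prefix k → Displaced (suc k) x → Displaced k x ⊎ ¬ S (suc k) x ≡ S k x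
      displaced-or-moved {x} _ displaced with S (suc k) x ℤ.≟ S k x
      ... | no moved = inj₂ moved
      ... | yes same = inj₁ λ (x∈R , settled) →
        displaced (subst (λ r → x ∈ prefix r × S (suc k) x ≡ S r x) (sym R≡) (x∈R , trans same settled))
      Φ-grows : Φ (suc k) ≤ Φ k + shiftedMovesAt k
      Φ-grows with take-suc-∷ʳ k σ k<N
      ... | v , eq = begin
        Φ (suc k)                                             ≡⟨ cong (length ∘ filter (displaced? (suc k))) eq ⟩
        length (filter (displaced? (suc k)) (prefix k ∷ʳ v))  ≤⟨ length-filter-∷ʳ (displaced? (suc k)) (prefix k) v ⟩
        length (filter (displaced? (suc k)) (prefix k)) + 1   ≤⟨ ℕP.+-monoˡ-≤ 1 (length-filter-⊎ _ (displaced? k) (moved? k) (prefix k) displaced-or-moved) ⟩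
        Φ k + movedByPS k + 1                                 ≡⟨ ℕP.+-assoc (Φ k) (movedByPS k) 1 ⟩
        Φ k + (movedByPS k + 1)                               ≡⟨ cong (λ n → Φ k + n) (ℕP.+-comm (movedByPS k) 1) ⟩
        Φ k + shiftedMovesAt k                                ∎

    step-with-recentring : ∀ k → k < N → R (suc k) ≡ suc k → ¬ Fits (prefix (suc k)) (B k) →
                        classicMovesAt k + Φ (suc k) ≤ Φ k + 2 * shiftedMovesAt k
    step-with-recentring k k<N R≡ ¬fits = begin
      classicMovesAt k + Φ (suc k)     ≡⟨ cong (λ n → classicMovesAt k + n) Φ-vanishes ⟩
      classicMovesAt k + 0             ≡⟨ ℕP.+-identityʳ (classicMovesAt k) ⟩
      classicMovesAt k                 ≤⟨ s≤s (ℕP.≤-trans (length-filter _ (prefix k)) (ℕP.≤-reflexive (length-take-≤ k σ k≤N))) ⟩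
      suc k                            ≤⟨ s≤s all-displaced-or-moved ⟩
      suc (Φ k + movedByPS k)          ≡⟨ ℕP.+-suc (Φ k) (movedByPS k) ⟨
      Φ k + shiftedMovesAt k           ≤⟨ ℕP.+-monoʳ-≤ (Φ k) (ℕP.m≤m+n (shiftedMovesAt k) _) ⟩
      Φ k + 2 * shiftedMovesAt k       ∎
      where
      open ℕP.≤-Reasoning
      k≤N : k ≤ N
      k≤N = ℕP.<⇒≤ k<N
      Φ-vanishes : Φ (suc k) ≡ 0
      Φ-vanishes = cong length (filter-none (displaced? (suc k)) (All.tabulate λ {x} x∈ displaced →
        displaced (subst (λ r → x ∈ prefix r × S (suc k) x ≡ S r x) (sym R≡) (x∈ , refl))))
      displaced-or-moved : ∀ {x} → x ∈ prefix k → Displaced k x ⊎ ¬ S (suc k) x ≡ S k x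
      displaced-or-moved {x} x∈ with (x ∈? prefix (R k)) ×-dec (S k x ℤ.≟ S (R k) x)
      ... | no unsettled = inj₁ unsettled
      ... | yes (x∈R , settled) with S (suc k) x ℤ.≟ S k x
      ...   | no moved = inj₂ moved
      ...   | yes same = ⊥-elim (¬fits (unchanged-since-recentring⇒fits k k<N x∈ x∈R (trans same settled)))
      all-displaced-or-moved : k ≤ Φ k + movedByPS k
      all-displaced-or-moved = subst (_≤ Φ k + movedByPS k) (length-take-≤ k σ k≤N)
        (length≤length-filter-⊎ (displaced? k) (moved? k) (prefix k) displaced-or-moved)

    amortised-step : ∀ k → k < N → classicMovesAt k + Φ (suc k) ≤ Φ k + 2 * shiftedMovesAt k
    amortised-step k k<N with advance-cases (prefix (suc k)) (suc k) (frameAfter σ k)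
    ... | inj₁ (_ , eq)     = step-without-recentring k k<N (cong recentredAt eq) (cong base eq)
    ... | inj₂ (¬fits , eq) = step-with-recentring k k<N (cong recentredAt eq) ¬fits

    classicMoves-bound : classicMoves P* σ ≤ 2 * shiftedMoves PS σ
    classicMoves-bound = sumUpTo-potential 2 classicMovesAt shiftedMovesAt Φ N refl amortised-step

lemma3 : {U : Set} (_<_ : U → U → Set) → IsStrictTotalOrder _≡_ _<_ →
         (n m : ℕ) (PS : Algorithm U ℤ) →
         ∃ λ (P* : Algorithm U ℕ) →
           ∀ (σ : List U) → Unique σ → length σ ≤ n →
           ShiftedHandles _<_ m PS σ →
           ClassicHandles _<_ (3 * m) P* σ × classicMoves P* σ ≤ 2 * shiftedMoves PS σ
lemma3 _<_ isSTO _ m PS = P* , λ σ _ _ handles →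
  let open Analysis _<_ σ handles in classic-handles , classicMoves-bound
  where open Recentring (IsStrictTotalOrder._≟_ isSTO) m PS
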